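{- Let $T$ be a set of $LCL$-formulas and $\alpha$ an $LCL$-formula. If $T\vdash\alpha$, then $T\models\alpha$.
   Context: $CL$-terms: $M,N ::= x \mid \mathsf{S} \mid \mathsf{K} \mid \mathsf{I} \mid MN$ over a countable set $V$ of term variables; $FV(M)$ is the set of variables of $M$. $M=_{w,\eta}N$ means $M=N$ is provable in the equational theory $\mathcal{EQ}^\eta$ with axioms $M=M$, $\mathsf S MNL=(ML)(NL)$, $\mathsf K MN=M$, $\mathsf I M=M$ and rules of symmetry, transitivity, $M=N\Rightarrow MP=NP$, $M=N\Rightarrow PM=PN$, and extensionality (from $Mx=Nx$, $x\notin FV(M)\cup FV(N)$, infer $M=N$). Simple types $\sigma ::= a\mid\sigma\to\tau$ (set ${\sf Types}$). A basis is a set of declarations $x:\sigma$ with distinct variables; $CL_\rightarrow$ is the set of statements $M:\sigma$ derivable from some basis in simply typed combinatory logic (rules: $x:\sigma$ if $x:\sigma\in\Gamma$; $\mathsf S:(\sigma\to(\rho\to\tau))\to((\sigma\to\rho)\to(\sigma\to\tau))$; $\mathsf K:\sigma\to(\tau\to\sigma)$; $\mathsf I:\sigma\to\sigma$; from $M:\sigma\to\tau$, $N:\sigma$ infer $MN:\tau$). $LCL$-formulas: $\alpha,\beta ::= M:\sigma\mid\neg\alpha\mid\alpha\Rightarrow\beta$ with $M:\sigma\in CL_\rightarrow$ ($\wedge$ etc. defined classically). Axioms: (Ax1) $\mathsf S:(\sigma\to(\tau\to\rho))\to((\sigma\to\tau)\to(\sigma\to\rho))$; (Ax2) $\mathsf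 K:\sigma\to(\tau\to\sigma)$; (Ax3) $\mathsf I:\sigma\to\sigma$; (Ax4) $(M:\sigma\to\tau)\Rightarrow((N:\sigma)\Rightarrow(MN:\tau))$ when the three statements are in $CL_\rightarrow$; (Ax5) $M:\sigma\Rightarrow N:\sigma$ when $M=_{w,\eta}N$ and both statements are in $CL_\rightarrow$; (Ax6) $\alpha\Rightarrow(\beta\Rightarrow\alpha)$; (Ax7) $(\alpha\Rightarrow(\beta\Rightarrow\gamma))\Rightarrow((\alpha\Rightarrow\beta)\Rightarrow(\alpha\Rightarrow\gamma))$; (Ax8) $(\neg\alpha\Rightarrow\neg\beta)\Rightarrow((\neg\alpha\Rightarrow\beta)\Rightarrow\alpha)$; rule Modus Ponens. $T\vdash\alpha$: a finite sequence ending in $\alpha$ of axiom instances, members of $T$ and Modus Ponens consequences of earlier members. Semantics: an applicative structure for $LCL$ is $\langle D,\{A^\sigma\}_{\sigma\in{\sf Types}},\cdot,\mathbf s,\mathbf k,\mathbf i\rangle$ with $D$ nonempty, $A^\sigma\subseteq D$, $\cdot:D\times D\to D$ extensional (if $d_1\cdot e=d_2\cdot e$ for all $e$ then $d_1=d_2$) and mapping $A^{\sigma\to\tau}\times A^\sigma$ into $A^\tau$; $\mathbf s\in A^{(\sigma\to(\tau\to\rho))\to((\sigma\to\tau)\to(\sigma\to\rho))}$ for all $\sigma,\tau,\rho$ with $((\mathbf s\cdot d)\cdot e)\cdot f=(d\cdot f)\cdot(e\cdot f)$; $\mathbf k\in A^{\sigma\to(\tau\to\sigma)}$ for all $\sigma,\tau$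 with $(\mathbf k\cdot d)\cdot e=d$; $\mathbf i\in A^{\sigma\to\sigma}$ for all $\sigma$ with $\mathbf i\cdot d=d$. An $LCL$-model $\mathcal M_\rho$ is an applicative structure with an environment $\rho:V\to D$. Interpretation: $[\![x]\!]_\rho=\rho(x)$, $[\![\mathsf S]\!]_\rho=\mathbf s$, $[\![\mathsf K]\!]_\rho=\mathbf k$, $[\![\mathsf I]\!]_\rho=\mathbf i$, $[\![MN]\!]_\rho=[\![M]\!]_\rho\cdot[\![N]\!]_\rho$. Satisfaction: $\mathcal M_\rho\models M:\sigma$ iff $[\![M]\!]_\rho\in A^\sigma$; $\neg$ and $\Rightarrow$ (and $\wedge$) are interpreted classically. $T\models\alpha$ iff every model satisfying all formulas of $T$ satisfies $\alpha$. -}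

module Defs where

open import Data.Nat using (ℕ)
open import Data.Bool using (Bool; true; false; not; _∧_; _∨_)
open import Data.Maybe using (Maybe; just)
open import Data.List using (List; []; _∷_)
open import Data.List.Membership.Propositional using (_∈_)
open import Data.Product using (Σ; ∃; _×_; _,_)
open import Data.Sum using (_⊎_)
open import Relation.Nullary using (¬_)
open import Relation.Binary.PropositionalEquality using (_≡_)

Var : Set
Var = ℕ

data Term : Set where
  var : Var → Term
  S K I : Term
  _·_ : Term → Term → Term

infixl 9 _·_

data _∈FV_ (x : Var) : Term → Set where
  here : x ∈FV var x
  left : ∀ {M N} → x ∈FV M → x ∈FV (M · N)
  right : ∀ {M N} → x ∈FV N → x ∈FV (M · N)

data Type : Set where
  atom : ℕ → Type
  _⟶_ : Type → Type → Type

infixr 7 _⟶_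

data _=wη_ : Term → Term → Set where
  refl= : ∀ {M} → M =wη M
  S= : ∀ {M N L} → (S · M · N · L) =wη ((M · L) · (N · L))
  K= : ∀ {M N} → (K · M · N) =wη M
  I= : ∀ {M} → (I · M) =wη M
  sym= : ∀ {M N} → M =wη N → N =wη M
  trans= : ∀ {M N L} → M =wη N → N =wη L → M =wη L
  appL= : ∀ {M N P} → M =wη N → (M · P) =wη (N · P)
  appR= : ∀ {M N P} → M =wη N → (P · M) =wη (P · N)
  ext= : ∀ {M N} (x : Var) → ¬ (x ∈FV M) → ¬ (x ∈FV N) →
         (M · var x) =wη (N · var x) → M =wη N

Basis : Set
Basis = Var → Maybe Type

data _⊢_∶_ (Γ : Basis) : Term → Type → Set where
  ax-var : ∀ {x σ} → Γ x ≡ just σ → Γ ⊢ var x ∶ σ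
  ax-S : ∀ {σ ρ τ} → Γ ⊢ S ∶ ((σ ⟶ (ρ ⟶ τ)) ⟶ ((σ ⟶ ρ) ⟶ (σ ⟶ τ)))
  ax-K : ∀ {σ τ} → Γ ⊢ K ∶ (σ ⟶ (τ ⟶ σ))
  ax-I : ∀ {σ} → Γ ⊢ I ∶ (σ ⟶ σ)
  app : ∀ {M N σ τ} → Γ ⊢ M ∶ (σ ⟶ τ) → Γ ⊢ N ∶ σ → Γ ⊢ (M · N) ∶ τ

CL→ : Term → Type → Set
CL→ M σ = Σ Basis λ Γ → Γ ⊢ M ∶ σ

data Formula : Set where
  ⟨_∶_⟩[_] : (M : Term) (σ : Type) → CL→ M σ → Formula
  ¬F_ : Formula → Formula
  _⇒_ : Formula → Formula → Formula

infixr 5 _⇒_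

data Axiom : Formula → Set where
  ax1 : ∀ {σ τ ρ} (p : CL→ S ((σ ⟶ (τ ⟶ ρ)) ⟶ ((σ ⟶ τ) ⟶ (σ ⟶ ρ)))) →
        Axiom ⟨ S ∶ ((σ ⟶ (τ ⟶ ρ)) ⟶ ((σ ⟶ τ) ⟶ (σ ⟶ ρ))) ⟩[ p ]
  ax2 : ∀ {σ τ} (p : CL→ K (σ ⟶ (τ ⟶ σ))) → Axiom ⟨ K ∶ (σ ⟶ (τ ⟶ σ)) ⟩[ p ]
  ax3 : ∀ {σ} (p : CL→ I (σ ⟶ σ)) → Axiom ⟨ I ∶ (σ ⟶ σ) ⟩[ p ]
  ax4 : ∀ {M N σ τ} (p : CL→ M (σ ⟶ τ)) (q : CL→ N σ) (r : CL→ (M · N) τ) →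
        Axiom (⟨ M ∶ (σ ⟶ τ) ⟩[ p ] ⇒ (⟨ N ∶ σ ⟩[ q ] ⇒ ⟨ M · N ∶ τ ⟩[ r ]))
  ax5 : ∀ {M N σ} → M =wη N → (p : CL→ M σ) (q : CL→ N σ) →
        Axiom (⟨ M ∶ σ ⟩[ p ] ⇒ ⟨ N ∶ σ ⟩[ q ])
  ax6 : ∀ {α β} → Axiom (α ⇒ (β ⇒ α))
  ax7 : ∀ {α β γ} → Axiom ((α ⇒ (β ⇒ γ)) ⇒ ((α ⇒ β) ⇒ (α ⇒ γ)))
  ax8 : ∀ {α β} → Axiom ((¬F α ⇒ ¬F β) ⇒ ((¬F α ⇒ β) ⇒ α))

-- A sequence φ₁ … φₙ is stored
-- reversed, as the list φₙ ∷ … ∷ φ₁ ∷ [].  'Justified T prev φ' says φ is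
-- an axiom, a member of T, or follows by MP from earlier members prev.

Theory : Set₁
Theory = Formula → Set

data Justified (T : Theory) (prev : List Formula) (φ : Formula) : Set where
  by-axiom : Axiom φ → Justified T prev φ
  by-hyp : T φ → Justified T prev φ
  by-mp : ∀ {ψ} → ψ ∈ prev → (ψ ⇒ φ) ∈ prev → Justified T prev φ

data ProofSeq (T : Theory) : List Formula → Set where
  [] : ProofSeq T []
  _∷_ : ∀ {φ prev} → Justified T prev φ → ProofSeq T prev → ProofSeq T (φ ∷ prev)

_⊢L_ : Theory → Formula → Set
T ⊢L α = Σ (List Formula) λ prev → ProofSeq T (α ∷ prev)

-- Semantics.  Subsets A^σ ⊆ D are given classically by characteristic
-- functions D → Bool (so satisfaction is two-valued).

record ApplicativeStructure : Set₁ where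
  field
    D : Set
    inhabitant : D
    A : Type → D → Bool
    _∙_ : D → D → D
    extensional : ∀ d₁ d₂ → (∀ e → d₁ ∙ e ≡ d₂ ∙ e) → d₁ ≡ d₂
    closed : ∀ σ τ d e → A (σ ⟶ τ) d ≡ true → A σ e ≡ true → A τ (d ∙ e) ≡ true
    s k i : D
    s-typed : ∀ σ τ ρ → A ((σ ⟶ (τ ⟶ ρ)) ⟶ ((σ ⟶ τ) ⟶ (σ ⟶ ρ))) s ≡ true
    s-eq : ∀ d e f → ((s ∙ d) ∙ e) ∙ f ≡ (d ∙ f) ∙ (e ∙ f)
    k-typed : ∀ σ τ → A (σ ⟶ (τ ⟶ σ)) k ≡ true
    k-eq : ∀ d e → (k ∙ d) ∙ e ≡ d
    i-typed : ∀ σ → A (σ ⟶ σ) i ≡ true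
    i-eq : ∀ d → i ∙ d ≡ d

record Model : Set₁ where
  field
    struct : ApplicativeStructure
  open ApplicativeStructure struct public
  field
    env : Var → D

module _ (𝓜 : Model) where
  open Model 𝓜

  ⟦_⟧ : Term → D
  ⟦ var x ⟧ = env x
  ⟦ S ⟧ = s
  ⟦ K ⟧ = k
  ⟦ I ⟧ = i
  ⟦ M · N ⟧ = ⟦ M ⟧ ∙ ⟦ N ⟧

  sat : Formula → Bool
  sat ⟨ M ∶ σ ⟩[ _ ] = A σ ⟦ M ⟧
  sat (¬F α) = not (sat α)
  sat (α ⇒ β) = not (sat α) ∨ sat β

_⊨M_ : Model → Formula → Set
𝓜 ⊨M α = sat 𝓜 α ≡ true

_⊨_ : Theory → Formula → Set₁
T ⊨ α = (𝓜 : Model) → (∀ β → T β → 𝓜 ⊨M β) → 𝓜 ⊨M α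

-- Every axiom holds in every model and Modus Ponens preserves truth, so by
-- induction along a proof sequence each of its formulas holds in every model
-- of T.  The only non-trivial axiom is (Ax5): =wη-equal terms denote the same
-- element, where the extensionality rule is justified by extensionality of
-- application, after moving the fresh variable x to an arbitrary element e
-- (which does not change the denotations of M and N, as x ∉ FV(M) ∪ FV(N)).
module Submission where

open import Defs
open import Data.Nat using (_≟_)
open import Data.Bool using (Bool; true; false; not; _∨_)
open import Data.Empty using (⊥-elim)
open import Data.List.Relation.Unary.All as All using (All; []; _∷_)
open import Data.Product using (_,_)
open import Relation.Nullary using (¬_; yes; no)
open import Relation.Binary.PropositionalEquality using (_≡_; refl; sym; trans; cong; cong₂; subst; module ≡-Reasoning)
open ≡-Reasoning

_⇒ᵇ_ : Bool → Bool → Bool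
a ⇒ᵇ b = not a ∨ b

infixr 5 _⇒ᵇ_

⇒ᵇ-intro : ∀ a b → (a ≡ true → b ≡ true) → a ⇒ᵇ b ≡ true
⇒ᵇ-intro false b _ = refl
⇒ᵇ-intro true  b h = h refl

⇒ᵇ-elim : ∀ {a b} → a ⇒ᵇ b ≡ true → a ≡ true → b ≡ true
⇒ᵇ-elim {true} h refl = h

⇒ᵇ-weaken : ∀ a b → a ⇒ᵇ (b ⇒ᵇ a) ≡ true
⇒ᵇ-weaken false b     = refl
⇒ᵇ-weaken true  false = refl
⇒ᵇ-weaken true  true  = refl

⇒ᵇ-distrib : ∀ a b c → (a ⇒ᵇ (b ⇒ᵇ c)) ⇒ᵇ ((a ⇒ᵇ b) ⇒ᵇ (a ⇒ᵇ c)) ≡ true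
⇒ᵇ-distrib false b     c     = refl
⇒ᵇ-distrib true  false c     = refl
⇒ᵇ-distrib true  true  false = refl
⇒ᵇ-distrib true  true  true  = refl

⇒ᵇ-reductio : ∀ a b → (not a ⇒ᵇ not b) ⇒ᵇ ((not a ⇒ᵇ b) ⇒ᵇ a) ≡ true
⇒ᵇ-reductio false false = refl
⇒ᵇ-reductio false true  = refl
⇒ᵇ-reductio true  b     = refl

update : ∀ {A : Set} → (Var → A) → Var → A → Var → A
update ρ x e y with y ≟ x
... | yes _ = e
... | no  _ = ρ y

update-same : ∀ {A : Set} (ρ : Var → A) x e → update ρ x e x ≡ e
update-same ρ x e with x ≟ x
... | yes _   = refl
... | no  x≢x = ⊥-elim (x≢x refl)

_[_≔_] : (𝓜 : Model) → Var → Model.D 𝓜 → Model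
𝓜 [ x ≔ e ] = record { struct = Model.struct 𝓜 ; env = update (Model.env 𝓜) x e }

⟦⟧-[≔]-∉FV : ∀ 𝓜 {x} e M → ¬ (x ∈FV M) → ⟦ 𝓜 [ x ≔ e ] ⟧ M ≡ ⟦ 𝓜 ⟧ M
⟦⟧-[≔]-∉FV 𝓜 {x} e (var y) x∉M with y ≟ x
... | yes refl = ⊥-elim (x∉M here)
... | no  _    = refl
⟦⟧-[≔]-∉FV 𝓜 e S x∉M = refl
⟦⟧-[≔]-∉FV 𝓜 e K x∉M = refl
⟦⟧-[≔]-∉FV 𝓜 e I x∉M = refl
⟦⟧-[≔]-∉FV 𝓜 e (M · N) x∉MN = cong₂ (Model._∙_ 𝓜)
  (⟦⟧-[≔]-∉FV 𝓜 e M (λ x∈M → x∉MN (left x∈M)))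
  (⟦⟧-[≔]-∉FV 𝓜 e N (λ x∈N → x∉MN (right x∈N)))

⟦⟧-resp-=wη : ∀ {M N} → M =wη N → (𝓜 : Model) → ⟦ 𝓜 ⟧ M ≡ ⟦ 𝓜 ⟧ N
⟦⟧-resp-=wη refl=        𝓜 = refl
⟦⟧-resp-=wη S=           𝓜 = Model.s-eq 𝓜 _ _ _
⟦⟧-resp-=wη K=           𝓜 = Model.k-eq 𝓜 _ _
⟦⟧-resp-=wη I=           𝓜 = Model.i-eq 𝓜 _
⟦⟧-resp-=wη (sym= p)     𝓜 = sym (⟦⟧-resp-=wη p 𝓜)
⟦⟧-resp-=wη (trans= p q) 𝓜 = trans (⟦⟧-resp-=wη p 𝓜) (⟦⟧-resp-=wη q 𝓜)
⟦⟧-resp-=wη (appL= p)    𝓜 = cong (λ d → Model._∙_ 𝓜 d _) (⟦⟧-resp-=wη p 𝓜)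
⟦⟧-resp-=wη (appR= p)    𝓜 = cong (Model._∙_ 𝓜 _) (⟦⟧-resp-=wη p 𝓜)
⟦⟧-resp-=wη (ext= {M} {N} x x∉M x∉N p) 𝓜 =
  Model.extensional 𝓜 _ _ λ e → begin
    ⟦ 𝓜 ⟧ M ∙ e                               ≡⟨ cong₂ _∙_ (sym (⟦⟧-[≔]-∉FV 𝓜 e M x∉M)) (sym (update-same env x e)) ⟩
    ⟦ 𝓜 [ x ≔ e ] ⟧ M ∙ update env x e x       ≡⟨ ⟦⟧-resp-=wη p (𝓜 [ x ≔ e ]) ⟩
    ⟦ 𝓜 [ x ≔ e ] ⟧ N ∙ update env x e x       ≡⟨ cong₂ _∙_ (⟦⟧-[≔]-∉FV 𝓜 e N x∉N) (update-same env x e) ⟩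
    ⟦ 𝓜 ⟧ N ∙ e                               ∎
  where open Model 𝓜 using (_∙_; env)

Axiom-sound : ∀ (𝓜 : Model) {φ} → Axiom φ → 𝓜 ⊨M φ
Axiom-sound 𝓜 (ax1 _) = Model.s-typed 𝓜 _ _ _
Axiom-sound 𝓜 (ax2 _) = Model.k-typed 𝓜 _ _
Axiom-sound 𝓜 (ax3 _) = Model.i-typed 𝓜 _
Axiom-sound 𝓜 (ax4 {M} {N} {σ} {τ} _ _ _) =
  ⇒ᵇ-intro (A (σ ⟶ τ) (⟦ 𝓜 ⟧ M)) _ λ M∈Aστ →
  ⇒ᵇ-intro (A σ (⟦ 𝓜 ⟧ N)) _ λ N∈Aσ → closed σ τ _ _ M∈Aστ N∈Aσ
  where open Model 𝓜 using (A; closed)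
Axiom-sound 𝓜 (ax5 {M} {N} {σ} M=N _ _) =
  ⇒ᵇ-intro (A σ (⟦ 𝓜 ⟧ M)) _ (subst (λ d → A σ d ≡ true) (⟦⟧-resp-=wη M=N 𝓜))
  where open Model 𝓜 using (A)
Axiom-sound 𝓜 (ax6 {α} {β})     = ⇒ᵇ-weaken (sat 𝓜 α) (sat 𝓜 β)
Axiom-sound 𝓜 (ax7 {α} {β} {γ}) = ⇒ᵇ-distrib (sat 𝓜 α) (sat 𝓜 β) (sat 𝓜 γ)
Axiom-sound 𝓜 (ax8 {α} {β})     = ⇒ᵇ-reductio (sat 𝓜 α) (sat 𝓜 β)

ProofSeq-sound : ∀ {T} (𝓜 : Model) → (∀ β → T β → 𝓜 ⊨M β) →
                 ∀ {l} → ProofSeq T l → All (𝓜 ⊨M_) l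
ProofSeq-sound 𝓜 ⊨T []       = []
ProofSeq-sound {T} 𝓜 ⊨T (_∷_ {prev = prev} j ps) = Justified-sound j ∷ ⊨prev
  where
  ⊨prev : All (𝓜 ⊨M_) prev
  ⊨prev = ProofSeq-sound 𝓜 ⊨T ps

  Justified-sound : ∀ {φ} → Justified T prev φ → 𝓜 ⊨M φ
  Justified-sound (by-axiom a)      = Axiom-sound 𝓜 a
  Justified-sound (by-hyp t)        = ⊨T _ t
  Justified-sound (by-mp ψ∈ ψ⇒φ∈) = ⇒ᵇ-elim (All.lookup ⊨prev ψ⇒φ∈) (All.lookup ⊨prev ψ∈)

mainTheorem7 : (T : Theory) (α : Formula) → T ⊢L α → T ⊨ α
mainTheorem7 T α (_ , ps) 𝓜 ⊨T = All.head (ProofSeq-sound 𝓜 ⊨T ps)
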